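{- Let $\mathbb{F}$ be a field, let $G$ be a finite simple graph, let $H$ be the underlying graph of the line digraph $\delta G$, and let $n$ be a positive integer. Then $H$ admits a homomorphism to $\mathcal{O}'(\mathbb{F},n)$ if and only if $G$ admits a homomorphism to $\mathcal{S}'(\mathbb{F},n)$.
   Context: For $x,y\in\mathbb{F}^n$, $\langle x,y\rangle=\sum_i x_iy_i$ over $\mathbb{F}$; for a subspace $U$, $U^{\perp}=\{w:\langle w,u\rangle=0\ \forall u\in U\}$. $\mathcal{O}'(\mathbb{F},n)$ is the graph whose vertices are all pairs $(u,w)\in\mathbb{F}^n\times\mathbb{F}^n$ with $\langle u,w\rangle\neq0$, two distinct pairs $(u_1,w_1),(u_2,w_2)$ being adjacent iff $\langle u_1,w_2\rangle=\langle u_2,w_1\rangle=0$. $\mathcal{S}'(\mathbb{F},n)$ is the graph whose vertices are all pairs $(U,W)$ of subspaces of $\mathbb{F}^n$, two distinct pairs $(U_1,W_1),(U_2,W_2)$ being adjacent iff there exist $u,w$ with $\langle u,w\rangle\neq0$, $u\in U_1\cap W_2^{\perp}$, $w\in W_1\cap U_2^{\perp}$, and there exist $u',w'$ with $\langle u',w'\rangle\ne0$, $u'\in U_2\cap W_1^{\perp}$, $w'\in W_2\cap U_1^{\perp}$. The line digraph $\delta G$ has as vertices all ordered pairs $(x,y)$ with $\{x,y\}$ an edge of $G$, with a directed edge from $(x,y)$ to $(z,w)$ whenever $y=z$; $H$ is obtained by ignoring directions. Homomorphisms map edges to edges. -}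

module Defs where

open import Level using (Level; _⊔_; suc; 0ℓ)
open import Data.Nat using (ℕ)
open import Data.Fin using (Fin)
open import Data.Bool using (Bool; true)
open import Data.Product using (Σ; Σ-syntax; ∃-syntax; _×_; _,_)
open import Data.Sum using (_⊎_)
open import Relation.Nullary using (¬_)
open import Relation.Binary.PropositionalEquality using (_≡_)
open import Algebra.Bundles using (CommutativeRing)
import Algebra.Definitions.RawMonoid as RawMonoidDefs

record Field (c ℓ : Level) : Set (suc (c ⊔ ℓ)) where
  field
    commutativeRing : CommutativeRing c ℓ
  open CommutativeRing commutativeRing public
  field
    1≉0     : ¬ (1# ≈ 0#)
    inverse : ∀ x → ¬ (x ≈ 0#) → Σ[ y ∈ Carrier ] (x * y ≈ 1#)

record Graph (v e : Level) : Set (suc (v ⊔ e)) where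
  field
    Vertex : Set v
    Adj    : Vertex → Vertex → Set e

open Graph public

Hom : ∀ {v e v' e'} → Graph v e → Graph v' e' → Set (v ⊔ e ⊔ v' ⊔ e')
Hom G K = Σ[ f ∈ (Vertex G → Vertex K) ] (∀ a b → Adj G a b → Adj K (f a) (f b))

record FinSimpleGraph : Set where
  field
    m      : ℕ
    E      : Fin m → Fin m → Bool
    sym    : ∀ x y → E x y ≡ true → E y x ≡ true
    irrefl : ∀ x → ¬ (E x x ≡ true)

asGraph : FinSimpleGraph → Graph 0ℓ 0ℓ
asGraph G = record
  { Vertex = Fin (FinSimpleGraph.m G)
  ; Adj    = λ x y → FinSimpleGraph.E G x y ≡ true }

-- H = underlying (undirected) graph of the line digraph δG:
-- vertices are ordered pairs (x , y) with {x , y} an edge of G;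
-- there is an arc (x , y) → (z , w) iff y ≡ z; H joins a and b iff
-- there is an arc a → b or an arc b → a.
lineDigraphUnderlying : FinSimpleGraph → Graph 0ℓ 0ℓ
lineDigraphUnderlying G = record
  { Vertex = Σ[ p ∈ Fin m × Fin m ] (E (proj₁' p) (proj₂' p) ≡ true)
  ; Adj    = λ { ((x , y) , _) ((z , w) , _) → (y ≡ z) ⊎ (w ≡ x) } }
  where
    open FinSimpleGraph G
    proj₁' : Fin m × Fin m → Fin m
    proj₁' (a , _) = a
    proj₂' : Fin m × Fin m → Fin m
    proj₂' (_ , b) = b

module _ {c ℓ : Level} (F : Field c ℓ) where
  open Field F

  Vec𝔽 : ℕ → Set c
  Vec𝔽 n = Fin n → Carrier

  ⟪_,_⟫ : ∀ {n} → Vec𝔽 n → Vec𝔽 n → Carrier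
  ⟪ x , y ⟫ = RawMonoidDefs.sum +-rawMonoid (λ i → x i * y i)

  _≋_ : ∀ {n} → Vec𝔽 n → Vec𝔽 n → Set ℓ
  x ≋ y = ∀ i → x i ≈ y i

  record Subspace (n : ℕ) : Set (suc (c ⊔ ℓ)) where
    field
      Mem      : Vec𝔽 n → Set (c ⊔ ℓ)
      Mem-resp : ∀ {x y} → x ≋ y → Mem x → Mem y
      Mem-0    : Mem (λ _ → 0#)
      Mem-+    : ∀ {x y} → Mem x → Mem y → Mem (λ i → x i + y i)
      Mem-*    : ∀ a {x} → Mem x → Mem (λ i → a * x i)
  open Subspace public

  _∈⊥_ : ∀ {n} → Vec𝔽 n → Subspace n → Set (c ⊔ ℓ)
  w ∈⊥ U = ∀ u → Mem U u → ⟪ w , u ⟫ ≈ 0#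

  _≐_ : ∀ {n} → Subspace n → Subspace n → Set (c ⊔ ℓ)
  U ≐ V = ∀ x → (Mem U x → Mem V x) × (Mem V x → Mem U x)

  O' : ℕ → Graph (c ⊔ ℓ) ℓ
  O' n = record
    { Vertex = Σ[ p ∈ Vec𝔽 n × Vec𝔽 n ] ¬ (⟪ fst p , snd p ⟫ ≈ 0#)
    ; Adj    = λ { ((u₁ , w₁) , _) ((u₂ , w₂) , _) →
                   ¬ (u₁ ≋ u₂ × w₁ ≋ w₂)
                   × ⟪ u₁ , w₂ ⟫ ≈ 0# × ⟪ u₂ , w₁ ⟫ ≈ 0# } }
    where
      fst : Vec𝔽 n × Vec𝔽 n → Vec𝔽 n
      fst (a , _) = a
      snd : Vec𝔽 n × Vec𝔽 n → Vec𝔽 n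
      snd (_ , b) = b

  S' : ℕ → Graph (suc (c ⊔ ℓ)) (c ⊔ ℓ)
  S' n = record
    { Vertex = Subspace n × Subspace n
    ; Adj    = λ { (U₁ , W₁) (U₂ , W₂) →
                   ¬ (U₁ ≐ U₂ × W₁ ≐ W₂)
                   × (∃[ u ] ∃[ w ] ( ¬ (⟪ u , w ⟫ ≈ 0#)
                                    × Mem U₁ u × u ∈⊥ W₂
                                    × Mem W₁ w × w ∈⊥ U₂ ))
                   × (∃[ u' ] ∃[ w' ] ( ¬ (⟪ u' , w' ⟫ ≈ 0#)
                                      × Mem U₂ u' × u' ∈⊥ W₁
                                      × Mem W₂ w' × w' ∈⊥ U₁ )) } }

-- A
-- homomorphism δG → 𝒪' labels each arc (x, y) by a pair (u, w) with
-- ⟨u, w⟩ ≠ 0, orthogonal "across" every consecutive arc (a, x) → (x, y).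
-- Given such a labelling, send x to the pair of subspaces annihilating the
-- labels of the arcs entering x: W-labels for U x, U-labels for W x.  Then
-- the label of (x, y) lies in U x × W x and is orthogonal to W y × U y,
-- which is precisely one half of 𝒮'-adjacency.  Conversely, a homomorphism
-- G → 𝒮' supplies such a witness (u, w) for every arc, and witnesses of two
-- consecutive arcs are orthogonal because both meet the subspaces of the
-- common vertex.
module Submission where

open import Defs
open import Data.Nat using (ℕ; _≤_)
open import Data.Fin using (Fin)
open import Data.Bool using (true)
open import Data.Product using (Σ; Σ-syntax; ∃-syntax; _×_; _,_; proj₁; proj₂)
open import Data.Sum using (inj₁; inj₂)
open import Relation.Nullary using (¬_)
open import Level using (Level; _⊔_; Lift; lift)
open import Relation.Binary.PropositionalEquality as ≡ using (_≡_)
open import Function.Bundles using (_⇔_; mk⇔)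
import Algebra.Properties.Semiring.Sum as SemiringSum
import Relation.Binary.Reasoning.Setoid as SetoidReasoning

module InnerProduct {c ℓ : Level} (F : Field c ℓ) where
  open Field F
  open SemiringSum semiring
  open SetoidReasoning setoid

  ⟪⟫-cong : ∀ {n} {x x′ y y′ : Vec𝔽 F n} → _≋_ F x x′ → _≋_ F y y′ →
            ⟪_,_⟫ F x y ≈ ⟪_,_⟫ F x′ y′
  ⟪⟫-cong x≋x′ y≋y′ = sum-cong-≋ (λ i → *-cong (x≋x′ i) (y≋y′ i))

  ⟪⟫-comm : ∀ {n} (x y : Vec𝔽 F n) → ⟪_,_⟫ F x y ≈ ⟪_,_⟫ F y x
  ⟪⟫-comm x y = sum-cong-≋ (λ i → *-comm (x i) (y i))

  ⟪⟫-zeroˡ : ∀ {n} (y : Vec𝔽 F n) → ⟪_,_⟫ F (λ _ → 0#) y ≈ 0#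
  ⟪⟫-zeroˡ {n} y = begin
    ⟪_,_⟫ F (λ _ → 0#) y  ≈⟨ sum-cong-≋ (λ i → zeroˡ (y i)) ⟩
    sum {n} (λ _ → 0#)    ≈⟨ sum-replicate-zero n ⟩
    0#                    ∎

  ⟪⟫-distribʳ-+ : ∀ {n} (x x′ y : Vec𝔽 F n) →
                  ⟪_,_⟫ F (λ i → x i + x′ i) y ≈ ⟪_,_⟫ F x y + ⟪_,_⟫ F x′ y
  ⟪⟫-distribʳ-+ x x′ y = begin
    ⟪_,_⟫ F (λ i → x i + x′ i) y          ≈⟨ sum-cong-≋ (λ i → distribʳ (y i) (x i) (x′ i)) ⟩
    sum (λ i → x i * y i + x′ i * y i)    ≈⟨ ∑-distrib-+ (λ i → x i * y i) (λ i → x′ i * y i) ⟩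
    ⟪_,_⟫ F x y + ⟪_,_⟫ F x′ y            ∎

  ⟪⟫-homoˡ : ∀ {n} a (x y : Vec𝔽 F n) → ⟪_,_⟫ F (λ i → a * x i) y ≈ a * ⟪_,_⟫ F x y
  ⟪⟫-homoˡ a x y = begin
    ⟪_,_⟫ F (λ i → a * x i) y   ≈⟨ sum-cong-≋ (λ i → *-assoc a (x i) (y i)) ⟩
    sum (λ i → a * (x i * y i)) ≈⟨ *-distribˡ-sum a (λ i → x i * y i) ⟨
    a * ⟪_,_⟫ F x y             ∎

module Subspaces {c ℓ : Level} (F : Field c ℓ) {n : ℕ} where
  open Field F
  open InnerProduct F

  annihilator : {I : Set} → (I → Vec𝔽 F n) → Subspace F n
  annihilator a = record
    { Mem      = λ v → Lift c (∀ i → ⟪_,_⟫ F v (a i) ≈ 0#)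
    ; Mem-resp = λ x≋y (lift x⊥a) → lift λ i →
        trans (⟪⟫-cong (λ j → sym (x≋y j)) (λ _ → refl)) (x⊥a i)
    ; Mem-0    = lift λ i → ⟪⟫-zeroˡ (a i)
    ; Mem-+    = λ {x} {y} (lift x⊥a) (lift y⊥a) → lift λ i →
        trans (⟪⟫-distribʳ-+ x y (a i)) (trans (+-cong (x⊥a i) (y⊥a i)) (+-identityˡ 0#))
    ; Mem-*    = λ b {x} (lift x⊥a) → lift λ i →
        trans (⟪⟫-homoˡ b x (a i)) (trans (*-congˡ (x⊥a i)) (zeroʳ b))
    }

  Linked : Subspace F n × Subspace F n → Subspace F n × Subspace F n → Set (c ⊔ ℓ)
  Linked (U₁ , W₁) (U₂ , W₂) =
    ∃[ u ] ∃[ w ] ( ¬ (⟪_,_⟫ F u w ≈ 0#)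
                  × Mem U₁ u × _∈⊥_ F u W₂
                  × Mem W₁ w × _∈⊥_ F w U₂ )

  linked⇒distinct : ∀ {p q} → Linked p q →
                    ¬ (_≐_ F (proj₁ p) (proj₁ q) × _≐_ F (proj₂ p) (proj₂ q))
  linked⇒distinct (u , w , ⟪u,w⟫≉0 , _ , u⊥W₂ , w∈W₁ , _) (_ , W₁≐W₂) =
    ⟪u,w⟫≉0 (u⊥W₂ w (proj₁ (W₁≐W₂ w) w∈W₁))

  linked⇒S'-adjacent : ∀ {p q} → Linked p q → Linked q p → Adj (S' F n) p q
  linked⇒S'-adjacent {p} {q} pq qp = linked⇒distinct {p} {q} pq , pq , qp

  linkLabel : ∀ {p q} → Linked p q → Vertex (O' F n)
  linkLabel (u , w , ⟪u,w⟫≉0 , _) = (u , w) , ⟪u,w⟫≉0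

  consecutive-links-O'-adjacent : ∀ {p q r} (pq : Linked p q) (qr : Linked q r) →
                                  Adj (O' F n) (linkLabel {p} {q} pq) (linkLabel {q} {r} qr)
  consecutive-links-O'-adjacent {p} {q} {r}
    (u₁ , w₁ , ⟪u₁,w₁⟫≉0 , _ , u₁⊥W , _ , w₁⊥U)
    (u₂ , w₂ , _ , u₂∈U , _ , w₂∈W , _) =
      (λ (_ , w₁≋w₂) → ⟪u₁,w₁⟫≉0 (trans (⟪⟫-cong (λ _ → refl) w₁≋w₂) ⟪u₁,w₂⟫≈0))
    , ⟪u₁,w₂⟫≈0
    , trans (⟪⟫-comm u₂ w₁) (w₁⊥U u₂ u₂∈U)
    where ⟪u₁,w₂⟫≈0 = u₁⊥W w₂ w₂∈W

O'-adjacent-sym : ∀ {c ℓ} (F : Field c ℓ) {n} {a b : Vertex (O' F n)} →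
                  Adj (O' F n) a b → Adj (O' F n) b a
O'-adjacent-sym F (a≉b , ⟪u₁,w₂⟫≈0 , ⟪u₂,w₁⟫≈0) =
  (λ (u≋ , w≋) → a≉b ((λ i → Field.sym F (u≋ i)) , (λ i → Field.sym F (w≋ i))))
  , ⟪u₂,w₁⟫≈0 , ⟪u₁,w₂⟫≈0

module LineDigraph {c ℓ : Level} (F : Field c ℓ) (G : FinSimpleGraph) (n : ℕ) where
  open Field F
  open FinSimpleGraph G
  open InnerProduct F
  open Subspaces F {n}

  Arc : Set
  Arc = Vertex (lineDigraphUnderlying G)

  module _ (φ : Hom (lineDigraphUnderlying G) (O' F n)) where
    open Σ φ renaming (proj₁ to f; proj₂ to f-hom)

    u w : ∀ x y → E x y ≡ true → Vec𝔽 F n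
    u x y xy = proj₁ (proj₁ (f ((x , y) , xy)))
    w x y xy = proj₂ (proj₁ (f ((x , y) , xy)))

    Incoming : Fin m → Set
    Incoming x = Σ[ a ∈ Fin m ] (E a x ≡ true)

    vertexPair : Fin m → Subspace F n × Subspace F n
    vertexPair x = annihilator (λ ((a , ax) : Incoming x) → w a x ax)
                 , annihilator (λ ((a , ax) : Incoming x) → u a x ax)

    arcLinked : ∀ x y (xy : E x y ≡ true) → Linked (vertexPair x) (vertexPair y)
    arcLinked x y xy =
      u x y xy , w x y xy , proj₂ (f ((x , y) , xy))
      , lift (λ (a , ax) → proj₂ (proj₂ (across a ax)))
      , (λ v (lift v⊥u) → trans (⟪⟫-comm (u x y xy) v) (v⊥u (x , xy)))
      , lift (λ (a , ax) → trans (⟪⟫-comm (w x y xy) (u a x ax)) (proj₁ (proj₂ (across a ax))))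
      , (λ v (lift v⊥w) → trans (⟪⟫-comm (w x y xy) v) (v⊥w (x , xy)))
      where
        across : ∀ a (ax : E a x ≡ true) → Adj (O' F n) (f ((a , x) , ax)) (f ((x , y) , xy))
        across a ax = f-hom ((a , x) , ax) ((x , y) , xy) (inj₁ ≡.refl)

    hom-to-S' : Hom (asGraph G) (S' F n)
    hom-to-S' = vertexPair , λ x y xy →
      linked⇒S'-adjacent {vertexPair x} {vertexPair y}
        (arcLinked x y xy) (arcLinked y x (FinSimpleGraph.sym G x y xy))

  module _ (γ : Hom (asGraph G) (S' F n)) where
    open Σ γ renaming (proj₁ to g; proj₂ to g-hom)

    arcLink : ∀ x y (xy : E x y ≡ true) → Linked (g x) (g y)
    arcLink x y xy = proj₁ (proj₂ (g-hom x y xy))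

    label : Arc → Vertex (O' F n)
    label ((x , y) , xy) = linkLabel {g x} {g y} (arcLink x y xy)

    hom-to-O' : Hom (lineDigraphUnderlying G) (O' F n)
    hom-to-O' = label , λ where
      ((x , y) , xy) ((_ , z) , yz) (inj₁ ≡.refl) →
        consecutive-links-O'-adjacent {g x} {g y} {g z} (arcLink x y xy) (arcLink y z yz)
      ((y , z) , yz) ((x , _) , xy) (inj₂ ≡.refl) →
        O'-adjacent-sym F {a = label ((x , y) , xy)} {b = label ((y , z) , yz)}
          (consecutive-links-O'-adjacent {g x} {g y} {g z} (arcLink x y xy) (arcLink y z yz))

-- The equivalence holds for every n.
lemma3p12 : ∀ {c ℓ} (F : Field c ℓ) (G : FinSimpleGraph) (n : ℕ) → 1 ≤ n →
    Hom (lineDigraphUnderlying G) (O' F n) ⇔ Hom (asGraph G) (S' F n)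
lemma3p12 F G n _ = mk⇔ hom-to-S' hom-to-O'
  where open LineDigraph F G n
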